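{- Let $m$, $n$, $r$, $u$ and $v$ be non-negative integers. If $\{(s_k),(\sigma_k)\}$ and $\{(t_k),(\tau_k)\}$, $k=0,1,2,\ldots$, are binomial-transform pairs of the first kind, then \[ \sum_{k=0}^n(-1)^k\binom nk\sum_{p=0}^r(-1)^p\binom rp s_{n-k+p+m}\sum_{j=0}^u(-1)^j\binom uj t_{k+j+v} =\sum_{k=0}^n(-1)^k\binom nk\sum_{p=0}^m(-1)^p\binom mp\sigma_{k+p+r}\sum_{j=0}^v(-1)^j\binom vj\tau_{n-k+j+u}. \]
   Context: Two sequences $(s_k)_{k\ge0}$ and $(\sigma_k)_{k\ge0}$ of complex numbers form a binomial-transform pair of the first kind if $\sigma_n=\sum_{k=0}^n(-1)^k\binom nk s_k$ for every non-negative integer $n$. -}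

module Defs where

open import Level using (Level)
open import Data.Nat using (ℕ; zero; suc; _∸_)
open import Data.Nat.Combinatorics using (_C_)
open import Algebra.Bundles using (CommutativeRing)

module BinomialDefs {c ℓ : Level} (R : CommutativeRing c ℓ) where
  open CommutativeRing R

  _·_ : ℕ → Carrier → Carrier
  zero  · x = 0#
  suc m · x = x + (m · x)

  sign : ℕ → Carrier
  sign zero    = 1#
  sign (suc k) = - sign k

  sumTo : ℕ → (ℕ → Carrier) → Carrier
  sumTo zero    f = f 0
  sumTo (suc n) f = sumTo n f + f (suc n)

  altBinSum : ℕ → (ℕ → Carrier) → Carrier
  altBinSum n f = sumTo n (λ k → sign k * ((n C k) · f k))

  BinomialPair : (ℕ → Carrier) → (ℕ → Carrier) → Set ℓ
  BinomialPair s σ = ∀ n → σ n ≈ altBinSum n s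

-- Write Δ f a = f a − f (a + 1).  Pascal's rule gives ∑ₖ (−1)ᵏ C(n,k) f (a + k) = Δⁿ f a,
-- so a binomial pair is σ N = Δᴺ s 0, and then Δᵐ σ b = Δᵇ s m.  Consequently
-- ∑ₚ (−1)ᵖ C(m,p) σ (k + p + r) = Δᵏ (Δʳ s) m is the k-th binomial transform of
-- a ↦ ∑ₚ (−1)ᵖ C(r,p) s (a + p + m), and likewise for (t, τ).  The identity thus reduces to
-- ∑ₖ (−1)ᵏ C(n,k) f (n − k) g k = ∑ₖ (−1)ᵏ C(n,k) (Bg)(n − k) (Bf)(k) for the binomial
-- transform B; with E₁, E₂ the shifts acting on f ⊗ g this says
-- (E₁ − E₂)ⁿ = ((1 − E₂) − (1 − E₁))ⁿ, and it follows by induction on n.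
module Submission where

open import Defs
open import Data.Nat using (ℕ; zero; suc; _+_; _∸_; _≤_; z≤n)
open import Algebra.Bundles using (CommutativeRing)
open import Data.Nat.Properties as ℕₚ using (≤-refl; m≤n⇒m≤1+n; n<1+n; +-∸-assoc; +-suc)
open import Data.Nat.Combinatorics using (_C_; nCk+nC[k+1]≡[n+1]C[k+1]; k>n⇒nCk≡0)
open import Function using (_∘_)
import Relation.Binary.PropositionalEquality as ≡
import Relation.Binary.Reasoning.Setoid as SetoidReasoning
import Algebra.Properties.Ring as RingProperties
import Algebra.Properties.AbelianGroup as AbelianGroupProperties
import Algebra.Properties.Group as GroupProperties
import Algebra.Properties.CommutativeSemigroup as CommutativeSemigroupProperties

open CommutativeSemigroupProperties ℕₚ.+-commutativeSemigroup using (xy∙z≈xz∙y; xy∙z≈zx∙y)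

module BinomialTransforms {c ℓ} (R : CommutativeRing c ℓ) where
  open CommutativeRing R renaming (_+_ to _⊕_)
  open BinomialDefs R
  open SetoidReasoning setoid
  open RingProperties ring using (-‿distribˡ-*; x[y-z]≈xy-xz; [y-z]x≈yx-zx)
  open AbelianGroupProperties +-abelianGroup using (⁻¹-anti-homo‿-; ⁻¹-∙-comm; xyx⁻¹≈y)
  open GroupProperties +-group using (\\-leftDividesʳ) renaming (//-cong₂ to -‿cong₂)
  open CommutativeSemigroupProperties +-commutativeSemigroup using (interchange)

  x-[x-y]≈y : ∀ x y → x - (x - y) ≈ y
  x-[x-y]≈y x y = begin
    x ⊕ - (x - y) ≈⟨ +-congˡ (⁻¹-anti-homo‿- x y) ⟩
    x ⊕ (y - x)   ≈⟨ +-assoc x y (- x) ⟨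
    x ⊕ y - x     ≈⟨ xyx⁻¹≈y x y ⟩
    y             ∎

  [x-y]-[x-z]≈z-y : ∀ x y z → (x - y) - (x - z) ≈ z - y
  [x-y]-[x-z]≈z-y x y z = begin
    (x - y) ⊕ - (x - z)    ≈⟨ +-comm (x - y) _ ⟩
    - (x - z) ⊕ (x - y)    ≈⟨ +-congʳ (⁻¹-anti-homo‿- x z) ⟩
    (z - x) ⊕ (x - y)      ≈⟨ +-assoc z (- x) (x - y) ⟩
    z ⊕ (- x ⊕ (x ⊕ - y))  ≈⟨ +-congˡ (\\-leftDividesʳ x (- y)) ⟩
    z - y                  ∎

  [x-y]+[z-w]≈[x+z]-[y+w] : ∀ x y z w → (x - y) ⊕ (z - w) ≈ (x ⊕ z) - (y ⊕ w)
  [x-y]+[z-w]≈[x+z]-[y+w] x y z w = trans (interchange x (- y) z (- w)) (+-congˡ (⁻¹-∙-comm y w))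

  sumTo-cong : ∀ n {f g : ℕ → Carrier} → (∀ {k} → k ≤ n → f k ≈ g k) → sumTo n f ≈ sumTo n g
  sumTo-cong zero    f≈g = f≈g z≤n
  sumTo-cong (suc n) f≈g = +-cong (sumTo-cong n (f≈g ∘ m≤n⇒m≤1+n)) (f≈g ≤-refl)

  sumTo-suc : ∀ n (f : ℕ → Carrier) → sumTo (suc n) f ≈ f 0 ⊕ sumTo n (f ∘ suc)
  sumTo-suc zero    f = refl
  sumTo-suc (suc n) f = trans (+-congʳ (sumTo-suc n f)) (+-assoc _ _ _)

  sumTo-sub : ∀ n (f g : ℕ → Carrier) → sumTo n (λ k → f k - g k) ≈ sumTo n f - sumTo n g
  sumTo-sub zero    f g = refl
  sumTo-sub (suc n) f g = trans (+-congʳ (sumTo-sub n f g)) ([x-y]+[z-w]≈[x+z]-[y+w] _ _ _ _)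

  ·-congˡ : ∀ n {x y} → x ≈ y → n · x ≈ n · y
  ·-congˡ zero    x≈y = refl
  ·-congˡ (suc n) x≈y = +-cong x≈y (·-congˡ n x≈y)

  ·-homo-+ : ∀ m n x → (m + n) · x ≈ m · x ⊕ n · x
  ·-homo-+ zero    n x = sym (+-identityˡ _)
  ·-homo-+ (suc m) n x = trans (+-congˡ (·-homo-+ m n x)) (sym (+-assoc _ _ _))

  ·-sub : ∀ n x y → n · (x - y) ≈ n · x - n · y
  ·-sub zero    x y = sym (-‿inverseʳ 0#)
  ·-sub (suc n) x y = trans (+-congˡ (·-sub n x y)) ([x-y]+[z-w]≈[x+z]-[y+w] _ _ _ _)

  altBinSum-cong≤ : ∀ n {f g : ℕ → Carrier} → (∀ {k} → k ≤ n → f k ≈ g k) →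
                    altBinSum n f ≈ altBinSum n g
  altBinSum-cong≤ n f≈g = sumTo-cong n (λ {k} k≤n → *-congˡ (·-congˡ (n C k) (f≈g k≤n)))

  altBinSum-cong : ∀ n {f g : ℕ → Carrier} → (∀ k → f k ≈ g k) → altBinSum n f ≈ altBinSum n g
  altBinSum-cong n f≈g = altBinSum-cong≤ n (λ {k} _ → f≈g k)

  altBinSum-zero : ∀ (f : ℕ → Carrier) → altBinSum 0 f ≈ f 0
  altBinSum-zero f = trans (*-identityˡ _) (+-identityʳ _)

  altBinSum-sub : ∀ n (f g : ℕ → Carrier) →
                  altBinSum n (λ k → f k - g k) ≈ altBinSum n f - altBinSum n g
  altBinSum-sub n f g = trans
    (sumTo-cong n (λ {k} _ → trans (*-congˡ (·-sub (n C k) (f k) (g k))) (x[y-z]≈xy-xz _ _ _)))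
    (sumTo-sub n _ _)

  altBinSum-suc : ∀ n (f : ℕ → Carrier) →
                  altBinSum (suc n) f ≈ altBinSum n f - altBinSum n (f ∘ suc)
  altBinSum-suc n f = begin
    sumTo (suc n) (term (suc n) f)
      ≈⟨ sumTo-suc n _ ⟩
    term n f 0 ⊕ sumTo n (term (suc n) f ∘ suc)
      ≈⟨ +-congˡ (trans (sumTo-cong n (λ {k} _ → pascal k)) (sumTo-sub n _ _)) ⟩
    term n f 0 ⊕ (sumTo n (term n f ∘ suc) - altBinSum n (f ∘ suc))
      ≈⟨ +-assoc _ _ _ ⟨
    term n f 0 ⊕ sumTo n (term n f ∘ suc) - altBinSum n (f ∘ suc)
      ≈⟨ +-congʳ (sumTo-suc n _) ⟨
    sumTo (suc n) (term n f) - altBinSum n (f ∘ suc)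
      ≈⟨ +-congʳ (trans (+-congˡ top-term-vanishes) (+-identityʳ _)) ⟩
    altBinSum n f - altBinSum n (f ∘ suc) ∎
    where
    term : ℕ → (ℕ → Carrier) → ℕ → Carrier
    term n f k = sign k * ((n C k) · f k)

    pascal : ∀ k → term (suc n) f (suc k) ≈ term n f (suc k) - term n (f ∘ suc) k
    pascal k = begin
      - sign k * ((suc n C suc k) · x)
        ≈⟨ *-congˡ (reflexive (≡.cong (_· x) (nCk+nC[k+1]≡[n+1]C[k+1] n k))) ⟨
      - sign k * ((n C k + n C suc k) · x)                    ≈⟨ *-congˡ (·-homo-+ (n C k) _ _) ⟩
      - sign k * ((n C k) · x ⊕ (n C suc k) · x)              ≈⟨ distribˡ _ _ _ ⟩
      - sign k * ((n C k) · x) ⊕ - sign k * ((n C suc k) · x) ≈⟨ +-comm _ _ ⟩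
      - sign k * ((n C suc k) · x) ⊕ - sign k * ((n C k) · x) ≈⟨ +-congˡ (-‿distribˡ-* _ _) ⟨
      term n f (suc k) - term n (f ∘ suc) k                   ∎
      where
      x : Carrier
      x = f (suc k)

    top-term-vanishes : term n f (suc n) ≈ 0#
    top-term-vanishes = trans (*-congˡ (reflexive (≡.cong (_· f (suc n)) (k>n⇒nCk≡0 (n<1+n n)))))
                              (zeroʳ _)

  Δ : ℕ → (ℕ → Carrier) → ℕ → Carrier
  Δ zero    f a = f a
  Δ (suc n) f a = Δ n f a - Δ n f (suc a)

  altBinSum-Δ : ∀ n (f : ℕ → Carrier) a → altBinSum n (λ p → f (a + p)) ≈ Δ n f a
  altBinSum-Δ zero    f a = trans (altBinSum-zero (λ p → f (a + p)))
                                  (reflexive (≡.cong f (ℕₚ.+-identityʳ a)))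
  altBinSum-Δ (suc n) f a = trans (altBinSum-suc n _) (-‿cong₂ (altBinSum-Δ n f a) shifted)
    where
    shifted : altBinSum n (λ p → f (a + suc p)) ≈ Δ n f (suc a)
    shifted = trans (altBinSum-cong n (λ p → reflexive (≡.cong f (+-suc a p))))
                    (altBinSum-Δ n f (suc a))

  Δ-+ : ∀ k r (f : ℕ → Carrier) a → Δ (k + r) f a ≈ Δ k (Δ r f) a
  Δ-+ zero    r f a = refl
  Δ-+ (suc k) r f a = -‿cong₂ (Δ-+ k r f a) (Δ-+ k r f (suc a))

  BinomialPair⇒Δ-swap : ∀ {s σ} → BinomialPair s σ → ∀ m b → Δ m σ b ≈ Δ b s m
  BinomialPair⇒Δ-swap {s} σ≈ zero    b = trans (σ≈ b) (altBinSum-Δ b s 0)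
  BinomialPair⇒Δ-swap {s} σ≈ (suc m) b = begin
    Δ m _ b - Δ m _ (suc b)             ≈⟨ -‿cong₂ (BinomialPair⇒Δ-swap σ≈ m b)
                                                   (BinomialPair⇒Δ-swap σ≈ m (suc b)) ⟩
    Δ b s m - (Δ b s m - Δ b s (suc m)) ≈⟨ x-[x-y]≈y _ _ ⟩
    Δ b s (suc m)                       ∎

  BinomialPair⇒exchange : ∀ {s σ} → BinomialPair s σ → ∀ m r k →
    altBinSum m (λ p → σ (k + p + r)) ≈ altBinSum k (λ a → altBinSum r (λ p → s (a + p + m)))
  BinomialPair⇒exchange {s} {σ} pair m r k = begin
    altBinSum m (λ p → σ (k + p + r))   ≈⟨ altBinSum-cong m (λ p → reflexive (≡.cong σ (xy∙z≈xz∙y k p r))) ⟩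
    altBinSum m (λ p → σ (k + r + p))   ≈⟨ altBinSum-Δ m σ (k + r) ⟩
    Δ m σ (k + r)                       ≈⟨ BinomialPair⇒Δ-swap pair m (k + r) ⟩
    Δ (k + r) s m                       ≈⟨ Δ-+ k r s m ⟩
    Δ k (Δ r s) m                       ≈⟨ altBinSum-Δ k (Δ r s) m ⟨
    altBinSum k (λ a → Δ r s (m + a))   ≈⟨ altBinSum-cong k inner ⟩
    altBinSum k (λ a → altBinSum r (λ p → s (a + p + m))) ∎
    where
    inner : ∀ a → Δ r s (m + a) ≈ altBinSum r (λ p → s (a + p + m))
    inner a = sym (trans (altBinSum-cong r (λ p → reflexive (≡.cong s (xy∙z≈zx∙y a p m))))
                         (altBinSum-Δ r s (m + a)))

  binomialTransform : (ℕ → Carrier) → ℕ → Carrier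
  binomialTransform f k = altBinSum k f

  binomialTransform-suc : ∀ (f : ℕ → Carrier) k →
    binomialTransform (f ∘ suc) k ≈ binomialTransform f k - binomialTransform f (suc k)
  binomialTransform-suc f k = sym (trans (-‿cong₂ refl (altBinSum-suc k f)) (x-[x-y]≈y _ _))

  altConv : ℕ → (ℕ → Carrier) → (ℕ → Carrier) → Carrier
  altConv n f g = altBinSum n (λ k → f (n ∸ k) * g k)

  altConv-cong : ∀ n {f f′ g g′ : ℕ → Carrier} → (∀ k → f k ≈ f′ k) → (∀ k → g k ≈ g′ k) →
                 altConv n f g ≈ altConv n f′ g′
  altConv-cong n f≈f′ g≈g′ = altBinSum-cong n (λ k → *-cong (f≈f′ _) (g≈g′ k))

  altConv-suc : ∀ n (f g : ℕ → Carrier) →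
                altConv (suc n) f g ≈ altConv n (f ∘ suc) g - altConv n f (g ∘ suc)
  altConv-suc n f g = trans (altBinSum-suc n _) (+-congʳ (altBinSum-cong≤ n (λ {k} k≤n →
    reflexive (≡.cong (λ i → f i * g k) (+-∸-assoc 1 k≤n)))))

  altConv-subˡ : ∀ n (f f′ g : ℕ → Carrier) →
                 altConv n (λ k → f k - f′ k) g ≈ altConv n f g - altConv n f′ g
  altConv-subˡ n f f′ g = trans (altBinSum-cong n (λ k → [y-z]x≈yx-zx _ _ _)) (altBinSum-sub n _ _)

  altConv-subʳ : ∀ n (f g g′ : ℕ → Carrier) →
                 altConv n f (λ k → g k - g′ k) ≈ altConv n f g - altConv n f g′
  altConv-subʳ n f g g′ = trans (altBinSum-cong n (λ k → x[y-z]≈xy-xz _ _ _)) (altBinSum-sub n _ _)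

  altConv-binomialTransform : ∀ n (f g : ℕ → Carrier) →
                              altConv n f g ≈ altConv n (binomialTransform g) (binomialTransform f)
  altConv-binomialTransform zero f g = begin
    altConv 0 f g    ≈⟨ altBinSum-zero (λ k → f (0 ∸ k) * g k) ⟩
    f 0 * g 0        ≈⟨ *-comm _ _ ⟩
    g 0 * f 0        ≈⟨ *-cong (altBinSum-zero g) (altBinSum-zero f) ⟨
    Bg 0 * Bf 0      ≈⟨ altBinSum-zero (λ k → Bg (0 ∸ k) * Bf k) ⟨
    altConv 0 Bg Bf  ∎
    where
    Bf Bg : ℕ → Carrier
    Bf = binomialTransform f
    Bg = binomialTransform g
  altConv-binomialTransform (suc n) f g = begin
    altConv (suc n) f g
      ≈⟨ altConv-suc n f g ⟩
    altConv n (f ∘ suc) g - altConv n f (g ∘ suc)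
      ≈⟨ -‿cong₂ (altConv-binomialTransform n (f ∘ suc) g) (altConv-binomialTransform n f (g ∘ suc)) ⟩
    altConv n Bg (binomialTransform (f ∘ suc)) - altConv n (binomialTransform (g ∘ suc)) Bf
      ≈⟨ -‿cong₂ (altConv-cong n {f = Bg} (λ _ → refl) (binomialTransform-suc f))
                 (altConv-cong n {g = Bf} (binomialTransform-suc g) (λ _ → refl)) ⟩
    altConv n Bg (λ k → Bf k - Bf (suc k)) - altConv n (λ k → Bg k - Bg (suc k)) Bf
      ≈⟨ -‿cong₂ (altConv-subʳ n Bg Bf (Bf ∘ suc)) (altConv-subˡ n Bg (Bg ∘ suc) Bf) ⟩
    (altConv n Bg Bf - altConv n Bg (Bf ∘ suc)) - (altConv n Bg Bf - altConv n (Bg ∘ suc) Bf)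
      ≈⟨ [x-y]-[x-z]≈z-y _ _ _ ⟩
    altConv n (Bg ∘ suc) Bf - altConv n Bg (Bf ∘ suc)
      ≈⟨ altConv-suc n Bg Bf ⟨
    altConv (suc n) Bg Bf ∎
    where
    Bf Bg : ℕ → Carrier
    Bf = binomialTransform f
    Bg = binomialTransform g

theorem13 : ∀ {c ℓ} (R : CommutativeRing c ℓ) →
    let open CommutativeRing R renaming (_+_ to _⊕_) in
    let open BinomialDefs R in
    (s σ t τ : ℕ → Carrier) → BinomialPair s σ → BinomialPair t τ →
    (m n r u v : ℕ) →
    altBinSum n (λ k → altBinSum r (λ p → s ((n ∸ k) + p + m))
                       * altBinSum u (λ j → t (k + j + v)))
    ≈ altBinSum n (λ k → altBinSum m (λ p → σ (k + p + r))
                       * altBinSum v (λ j → τ ((n ∸ k) + j + u)))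
theorem13 R s σ t τ sσ-pair tτ-pair m n r u v = begin
  altConv n S T
    ≈⟨ altConv-binomialTransform n S T ⟩
  altConv n (binomialTransform T) (binomialTransform S)
    ≈⟨ altBinSum-cong n (λ k → trans (*-comm _ _)
         (*-cong (sym (BinomialPair⇒exchange sσ-pair m r k))
                 (sym (BinomialPair⇒exchange tτ-pair v u (n ∸ k))))) ⟩
  altBinSum n (λ k → altBinSum m (λ p → σ (k + p + r)) * altBinSum v (λ j → τ (n ∸ k + j + u))) ∎
  where
  open CommutativeRing R using (Carrier; _*_; *-comm; *-cong; trans; sym; setoid)
  open BinomialDefs R using (altBinSum)
  open BinomialTransforms R
  open SetoidReasoning setoid
  S T : ℕ → Carrier
  S a = altBinSum r (λ p → s (a + p + m))
  T a = altBinSum u (λ j → t (a + j + v))
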